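{- For $m\ge1$ and $n\ge1$ let $f_{m,n}$ be the number of $m$-colored peak compositions of $n$. Then $f_{m,1}=m$, $f_{m,2}=m^2$, and $f_{m,n}=m f_{m,n-1}+f_{m,n-2}$ for $n\ge3$.
   Context: Let $\omega$ be a primitive $m$th root of unity. An $m$-colored composition of $n$ is a sequence $\alpha=(\omega^{j_1}\alpha_1,\ldots,\omega^{j_k}\alpha_k)$ of positive integers $\alpha_i$ summing to $n$, each with a color $j_i\in\{0,\ldots,m-1\}$. Its rainbow decomposition is the writing $\alpha=\alpha_{(1)}\alpha_{(2)}\cdots\alpha_{(r)}$ as a concatenation of maximal blocks of consecutive parts of the same color (so consecutive blocks have different colors). An (uncolored) peak composition is a composition all of whose parts except possibly the last are greater than $1$. An $m$-colored peak composition is an $m$-colored composition each block $\alpha_{(i)}$ of whose rainbow decomposition, with colors forgotten, is a peak composition. -}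

module Defs where

open import Data.Nat using (ℕ; zero; suc; _<ᵇ_; _≡ᵇ_)
open import Data.Fin using (Fin)
open import Data.Fin.Properties using (_≟_)
open import Data.Bool using (Bool; true; false; _∧_; if_then_else_; T)
open import Data.List using (List; []; _∷_; map)
open import Data.List.Base using (all)
open import Data.Nat.ListAction using (sum)
open import Data.Product using (Σ; _×_; _,_; proj₂)
open import Relation.Nullary.Decidable using (⌊_⌋)

-- An m-colored composition is a list of pairs (color j , part a),
-- representing (ω^j a). Colors are elements of Fin m.
ColoredComp : ℕ → Set
ColoredComp m = List (Fin m × ℕ)

partsPositive : ∀ {m} → ColoredComp m → Bool
partsPositive = all (λ p → 0 <ᵇ proj₂ p)

size : ∀ {m} → ColoredComp m → ℕ
size α = sum (map proj₂ α)

rainbow : ∀ {m} → ColoredComp m → List (Fin m × List ℕ)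
rainbow [] = []
rainbow ((c , a) ∷ xs) with rainbow xs
... | [] = (c , a ∷ []) ∷ []
... | (d , b) ∷ bs = if ⌊ c ≟ d ⌋ then (c , a ∷ b) ∷ bs
                                  else (c , a ∷ []) ∷ (d , b) ∷ bs

isPeak : List ℕ → Bool
isPeak [] = true
isPeak (a ∷ []) = true
isPeak (a ∷ b ∷ r) = (1 <ᵇ a) ∧ isPeak (b ∷ r)

isColoredPeak : ∀ {m} → ColoredComp m → Bool
isColoredPeak α = all (λ blk → isPeak (proj₂ blk)) (rainbow α)

PeakComp : ℕ → ℕ → Set
PeakComp m n = Σ (ColoredComp m) λ α →
  T (partsPositive α) × T (size α ≡ᵇ n) × T (isColoredPeak α)

-- Call a colored composition locally peak if all parts are positive and no part equal to 1
-- is followed by a part of the same color; these are exactly the colored peak compositions.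
-- Removing one unit from the first part of a locally peak composition of n + 1 (deleting
-- the part if it was a 1) gives a color together with a locally peak composition of n, and
-- this is reversible except when the first two parts are 2 and b of one color: removing the
-- unit would then produce a forbidden 1. Those compositions correspond, by deleting the 2,
-- to the nonempty locally peak compositions of n - 1, whence f(n+1) = m f(n) + f(n-1) as
-- soon as n - 1 ≥ 1.
module Submission where

open import Defs
open import Algebra.Bundles using (CommutativeMonoid)
open import Data.Bool using (Bool; true; _∧_; if_then_else_; T)
open import Data.Bool.Properties using (T-∧; T-irrelevant; ∧-assoc; ∧-commutativeMonoid)
open import Algebra.Properties.CommutativeSemigroup (CommutativeMonoid.commutativeSemigroup ∧-commutativeMonoid)
  using (interchange)
open import Data.Fin using (Fin)
open import Data.Fin.Properties using (_≟_; +↔⊎; *↔×; 1↔⊤)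
open import Data.List using (List; []; _∷_)
open import Data.Nat using (ℕ; zero; suc; _≤_; _*_; _+_; _∸_; _^_; _<ᵇ_; _≡ᵇ_; s≤s)
open import Data.Nat.Properties using (≡-irrelevant; ≡ᵇ⇒≡; ≡⇒≡ᵇ; suc-injective; +-identityʳ; *-identityʳ)
open import Data.Product using (Σ; _×_; _,_; proj₁; proj₂)
open import Data.Product.Function.NonDependent.Propositional using (_×-↔_)
open import Data.Sum using (_⊎_; inj₁; inj₂)
open import Data.Sum.Function.Propositional using (_⊎-↔_)
open import Data.Unit using (⊤; tt)
open import Function.Base using (id)
open import Function.Bundles using (_↔_; mk↔ₛ′; Equivalence)
open import Function.Properties.Inverse using (↔-sym; ↔-refl; ↔-trans)
open import Function.Related.Propositional using (module EquationalReasoning)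
open import Function.Related.TypeIsomorphisms using (Σ-assoc; Σ-distribʳ-⊎)
open import Level using (Level)
open import Relation.Binary.PropositionalEquality using (_≡_; _≢_; refl; cong; cong₂; sym; trans; subst; module ≡-Reasoning)
open import Relation.Nullary using (¬_; yes; no; contradiction; Irrelevant)
open import Relation.Nullary.Decidable using (⌊_⌋)

private
  variable
    a b p q : Level

×-irrelevant : {A : Set a} {B : Set b} → Irrelevant A → Irrelevant B → Irrelevant (A × B)
×-irrelevant irrA irrB (x , y) (x′ , y′) = cong₂ _,_ (irrA x x′) (irrB y y′)

module _ {A : Set a} {P : A → Set p} (P-irrelevant : ∀ x → Irrelevant (P x)) where

  proj₁-injective : {u v : Σ A P} → proj₁ u ≡ proj₁ v → u ≡ v
  proj₁-injective {x , pu} {_ , pv} refl = cong (x ,_) (P-irrelevant x pu pv)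

restrict-↔ : {A : Set a} {B : Set b} {P : A → Set p} {Q : B → Set q} →
             (∀ x → Irrelevant (P x)) → (∀ y → Irrelevant (Q y)) →
             (f : A → B) (g : B → A) →
             (∀ x → P x → Q (f x)) → (∀ y → Q y → P (g y)) →
             (∀ x → P x → g (f x) ≡ x) → (∀ y → Q y → f (g y) ≡ y) →
             Σ A P ↔ Σ B Q
restrict-↔ P-irr Q-irr f g f-resp g-resp g∘f f∘g = mk↔ₛ′
  (λ (x , px) → f x , f-resp x px)
  (λ (y , qy) → g y , g-resp y qy)
  (λ (y , qy) → proj₁-injective Q-irr (f∘g y qy))
  (λ (x , px) → proj₁-injective P-irr (g∘f x px))

data NonEmpty {A : Set a} : List A → Set a where
  nonEmpty : ∀ {x xs} → NonEmpty (x ∷ xs)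

NonEmpty-irrelevant : {A : Set a} {xs : List A} → Irrelevant (NonEmpty xs)
NonEmpty-irrelevant nonEmpty nonEmpty = refl

module _ {m : ℕ} where

  fitsBefore : Fin m → ℕ → ColoredComp m → Bool
  fitsBefore c a [] = true
  fitsBefore c a ((d , _) ∷ _) = if ⌊ c ≟ d ⌋ then 1 <ᵇ a else true

  isLocallyPeak : ColoredComp m → Bool
  isLocallyPeak [] = true
  isLocallyPeak ((c , a) ∷ β) = ((0 <ᵇ a) ∧ fitsBefore c a β) ∧ isLocallyPeak β

  pushPart : Fin m → ℕ → List (Fin m × List ℕ) → List (Fin m × List ℕ)
  pushPart c a [] = (c , a ∷ []) ∷ []
  pushPart c a ((d , b) ∷ bs) = if ⌊ c ≟ d ⌋ then (c , a ∷ b) ∷ bs else (c , a ∷ []) ∷ (d , b) ∷ bs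

  rainbow-∷ : ∀ c a (β : ColoredComp m) → rainbow ((c , a) ∷ β) ≡ pushPart c a (rainbow β)
  rainbow-∷ c a β with rainbow β
  ... | [] = refl
  ... | _ ∷ _ = refl

  rainbow-firstBlock : ∀ d b (β : ColoredComp m) →
                       Σ (List ℕ) λ L → Σ (List (Fin m × List ℕ)) λ bs → rainbow ((d , b) ∷ β) ≡ (d , b ∷ L) ∷ bs
  rainbow-firstBlock d b β rewrite rainbow-∷ d b β with rainbow β
  ... | [] = [] , [] , refl
  ... | (e , L) ∷ bs with d ≟ e
  ...   | yes refl = L , bs , refl
  ...   | no _ = [] , (e , L) ∷ bs , refl

  isColoredPeak-∷-∷ : ∀ c a d b (β : ColoredComp m) →
                      isColoredPeak ((c , a) ∷ (d , b) ∷ β) ≡ fitsBefore c a ((d , b) ∷ β) ∧ isColoredPeak ((d , b) ∷ β)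
  isColoredPeak-∷-∷ c a d b β with rainbow-firstBlock d b β
  ... | L , bs , eq rewrite rainbow-∷ c a ((d , b) ∷ β) | eq with c ≟ d
  ...   | yes refl = ∧-assoc (1 <ᵇ a) (isPeak (b ∷ L)) _
  ...   | no _ = refl

  isLocallyPeak≡partsPositive∧isColoredPeak : ∀ (α : ColoredComp m) → isLocallyPeak α ≡ partsPositive α ∧ isColoredPeak α
  isLocallyPeak≡partsPositive∧isColoredPeak [] = refl
  isLocallyPeak≡partsPositive∧isColoredPeak ((c , zero) ∷ []) = refl
  isLocallyPeak≡partsPositive∧isColoredPeak ((c , suc a) ∷ []) = refl
  isLocallyPeak≡partsPositive∧isColoredPeak ((c , a) ∷ δ@((d , b) ∷ β)) = begin
    ((0 <ᵇ a) ∧ fitsBefore c a δ) ∧ isLocallyPeak δ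
      ≡⟨ cong (((0 <ᵇ a) ∧ fitsBefore c a δ) ∧_) (isLocallyPeak≡partsPositive∧isColoredPeak δ) ⟩
    ((0 <ᵇ a) ∧ fitsBefore c a δ) ∧ (partsPositive δ ∧ isColoredPeak δ)
      ≡⟨ interchange (0 <ᵇ a) (fitsBefore c a δ) (partsPositive δ) (isColoredPeak δ) ⟩
    ((0 <ᵇ a) ∧ partsPositive δ) ∧ (fitsBefore c a δ ∧ isColoredPeak δ)
      ≡⟨ cong (((0 <ᵇ a) ∧ partsPositive δ) ∧_) (sym (isColoredPeak-∷-∷ c a d b β)) ⟩
    partsPositive ((c , a) ∷ δ) ∧ isColoredPeak ((c , a) ∷ δ) ∎
    where
    open ≡-Reasoning

  isLocallyPeak-tail : ∀ x β → T (isLocallyPeak (x ∷ β)) → T (isLocallyPeak β)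
  isLocallyPeak-tail x β lp = proj₂ (Equivalence.to T-∧ lp)

  isLocallyPeak-∷ : ∀ c a β → T (0 <ᵇ a) → T (fitsBefore c a β) → T (isLocallyPeak β) →
                    T (isLocallyPeak ((c , a) ∷ β))
  isLocallyPeak-∷ c a β pos fits lp = Equivalence.from T-∧ (Equivalence.from T-∧ (pos , fits) , lp)

  fitsBefore-≥2 : ∀ c a (β : ColoredComp m) → T (fitsBefore c (2 + a) β)
  fitsBefore-≥2 c a [] = tt
  fitsBefore-≥2 c a ((d , _) ∷ _) with c ≟ d
  ... | yes _ = tt
  ... | no _ = tt

  fitsBefore-≢ : ∀ {c d} a b δ → c ≢ d → T (fitsBefore c a ((d , b) ∷ δ))
  fitsBefore-≢ {c} {d} _ _ _ c≢d with c ≟ d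
  ... | yes c≡d = contradiction c≡d c≢d
  ... | no _ = tt

LocalPeak : ∀ {m} → ℕ → ColoredComp m → Set
LocalPeak n α = T (isLocallyPeak α) × size α ≡ n

-- The index is one more than the size: these are the compositions of size k ∸ 1 that
-- arise when the leading part 2 is deleted from a locally peak composition of k + 1.
LocalPeak⁺ : ∀ {m} → ℕ → ColoredComp m → Set
LocalPeak⁺ k β = NonEmpty β × T (isLocallyPeak β) × suc (size β) ≡ k

LocalPeakComp : ℕ → ℕ → Set
LocalPeakComp m n = Σ (ColoredComp m) (LocalPeak n)

LocalPeakComp⁺ : ℕ → ℕ → Set
LocalPeakComp⁺ m k = Σ (ColoredComp m) (LocalPeak⁺ k)

LocalPeak-irrelevant : ∀ {m n} (α : ColoredComp m) → Irrelevant (LocalPeak n α)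
LocalPeak-irrelevant _ = ×-irrelevant T-irrelevant ≡-irrelevant

LocalPeak⁺-irrelevant : ∀ {m k} (β : ColoredComp m) → Irrelevant (LocalPeak⁺ k β)
LocalPeak⁺-irrelevant _ = ×-irrelevant NonEmpty-irrelevant (×-irrelevant T-irrelevant ≡-irrelevant)

PeakComp↔LocalPeakComp : ∀ m n → PeakComp m n ↔ LocalPeakComp m n
PeakComp↔LocalPeakComp m n =
  restrict-↔ (λ _ → ×-irrelevant T-irrelevant (×-irrelevant T-irrelevant T-irrelevant))
             LocalPeak-irrelevant id id to from (λ _ _ → refl) (λ _ _ → refl)
  where
  to : ∀ α → T (partsPositive α) × T (size α ≡ᵇ n) × T (isColoredPeak α) → LocalPeak n α
  to α (pos , sz , pk) =
    subst T (sym (isLocallyPeak≡partsPositive∧isColoredPeak α)) (Equivalence.from T-∧ (pos , pk)) , ≡ᵇ⇒≡ _ _ sz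
  from : ∀ α → LocalPeak n α → T (partsPositive α) × T (size α ≡ᵇ n) × T (isColoredPeak α)
  from α (lp , sz) with Equivalence.to T-∧ (subst T (isLocallyPeak≡partsPositive∧isColoredPeak α) lp)
  ... | pos , pk = pos , ≡⇒≡ᵇ _ _ sz , pk

module _ {m : ℕ} where

  Split : Set
  Split = (Fin m × ColoredComp m) ⊎ ColoredComp m

  addUnit : Fin m → ColoredComp m → ColoredComp m
  addUnit c [] = (c , 1) ∷ []
  addUnit c ((d , b) ∷ δ) = if ⌊ c ≟ d ⌋ then (c , suc b) ∷ δ else (c , 1) ∷ (d , b) ∷ δ

  addUnit-same : ∀ c b δ → addUnit c ((c , b) ∷ δ) ≡ (c , suc b) ∷ δ
  addUnit-same c b δ with c ≟ c
  ... | yes _ = refl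
  ... | no c≢c = contradiction refl c≢c

  prependTwo : ColoredComp m → ColoredComp m
  prependTwo [] = []
  prependTwo ((d , b) ∷ δ) = (d , 2) ∷ (d , b) ∷ δ

  recompose : Split → ColoredComp m
  recompose (inj₁ (c , γ)) = addUnit c γ
  recompose (inj₂ β) = prependTwo β

  -- The two clauses returning inj₂ [] are junk: their inputs are not locally peak of positive size.
  decompose : ColoredComp m → Split
  decompose [] = inj₂ []
  decompose ((c , zero) ∷ β) = inj₂ []
  decompose ((c , 1) ∷ β) = inj₁ (c , β)
  decompose ((c , 2) ∷ []) = inj₁ (c , (c , 1) ∷ [])
  decompose ((c , 2) ∷ (d , b) ∷ δ) =
    if ⌊ c ≟ d ⌋ then inj₂ ((d , b) ∷ δ) else inj₁ (c , (c , 1) ∷ (d , b) ∷ δ)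
  decompose ((c , suc (suc (suc a))) ∷ β) = inj₁ (c , (c , suc (suc a)) ∷ β)

  Fits : ℕ → Split → Set
  Fits k (inj₁ (_ , γ)) = LocalPeak k γ
  Fits k (inj₂ β) = LocalPeak⁺ k β

  Fits-irrelevant : ∀ {k} r → Irrelevant (Fits k r)
  Fits-irrelevant (inj₁ (_ , γ)) = LocalPeak-irrelevant γ
  Fits-irrelevant (inj₂ β) = LocalPeak⁺-irrelevant β

  decompose-fits : ∀ {k} α → LocalPeak (suc k) α → Fits k (decompose α)
  decompose-fits ((c , 1) ∷ β) (lp , s) = isLocallyPeak-tail (c , 1) β lp , suc-injective s
  decompose-fits ((c , 2) ∷ []) (lp , s) = tt , suc-injective s
  decompose-fits ((c , 2) ∷ (d , b) ∷ δ) (lp , s) with c ≟ d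
  ... | yes refl = nonEmpty , lp , suc-injective s
  ... | no c≢d = isLocallyPeak-∷ c 1 ((d , b) ∷ δ) tt (fitsBefore-≢ 1 b δ c≢d) lp , suc-injective s
  decompose-fits ((c , suc (suc (suc a))) ∷ β) (lp , s) =
    isLocallyPeak-∷ c (2 + a) β tt (fitsBefore-≥2 c a β) (isLocallyPeak-tail (c , 3 + a) β lp) , suc-injective s

  recompose-fits : ∀ {k} r → Fits k r → LocalPeak (suc k) (recompose r)
  recompose-fits (inj₁ (c , [])) (lp , s) = tt , cong suc s
  recompose-fits (inj₁ (c , (d , b) ∷ δ)) (lp , s) with c ≟ d
  recompose-fits (inj₁ (c , (_ , suc b) ∷ δ)) (lp , s) | yes refl =
    isLocallyPeak-∷ c (2 + b) δ tt (fitsBefore-≥2 c b δ) (isLocallyPeak-tail (c , suc b) δ lp) , cong suc s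
  ... | no c≢d = isLocallyPeak-∷ c 1 ((d , b) ∷ δ) tt (fitsBefore-≢ 1 b δ c≢d) lp , cong suc s
  recompose-fits (inj₂ ((d , b) ∷ δ)) (_ , lp , s) =
    isLocallyPeak-∷ d 2 ((d , b) ∷ δ) tt (fitsBefore-≥2 d 0 ((d , b) ∷ δ)) lp , cong suc s

  recompose∘decompose : ∀ {k} α → LocalPeak (suc k) α → recompose (decompose α) ≡ α
  recompose∘decompose ((c , 1) ∷ []) _ = refl
  recompose∘decompose ((c , 1) ∷ (d , b) ∷ δ) (lp , _) with c ≟ d
  ... | yes refl = contradiction lp id
  ... | no _ = refl
  recompose∘decompose ((c , 2) ∷ []) _ = addUnit-same c 1 []
  recompose∘decompose ((c , 2) ∷ (d , b) ∷ δ) _ with c ≟ d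
  ... | yes refl = refl
  ... | no _ = addUnit-same c 1 ((d , b) ∷ δ)
  recompose∘decompose ((c , suc (suc (suc a))) ∷ β) _ = addUnit-same c (suc (suc a)) β

  decompose∘recompose : ∀ {k} r → Fits k r → decompose (recompose r) ≡ r
  decompose∘recompose (inj₁ (c , [])) _ = refl
  decompose∘recompose (inj₁ (c , (d , b) ∷ δ)) (lp , _) with c ≟ d
  decompose∘recompose (inj₁ (c , (_ , 1) ∷ [])) _ | yes refl = refl
  decompose∘recompose (inj₁ (c , (_ , 1) ∷ (e , b) ∷ δ)) (lp , _) | yes refl with c ≟ e
  ... | yes refl = contradiction lp id
  ... | no _ = refl
  decompose∘recompose (inj₁ (c , (_ , suc (suc b)) ∷ δ)) _ | yes refl = refl
  decompose∘recompose (inj₁ (c , (d , b) ∷ δ)) _ | no _ = refl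
  decompose∘recompose (inj₂ ((d , b) ∷ δ)) _ with d ≟ d
  ... | yes _ = refl
  ... | no d≢d = contradiction refl d≢d

LocalPeakComp-suc↔ : ∀ m k → LocalPeakComp m (suc k) ↔ ((Fin m × LocalPeakComp m k) ⊎ LocalPeakComp⁺ m k)
LocalPeakComp-suc↔ m k = begin
  LocalPeakComp m (suc k)
    ↔⟨ restrict-↔ LocalPeak-irrelevant Fits-irrelevant decompose recompose
                  decompose-fits recompose-fits recompose∘decompose decompose∘recompose ⟩
  Σ Split (Fits k)
    ↔⟨ Σ-distribʳ-⊎ ⟩
  (Σ (Fin m × ColoredComp m) (λ (_ , γ) → LocalPeak k γ) ⊎ LocalPeakComp⁺ m k)
    ↔⟨ Σ-assoc ⊎-↔ ↔-refl ⟩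
  ((Fin m × LocalPeakComp m k) ⊎ LocalPeakComp⁺ m k) ∎
  where open EquationalReasoning

empty↔Fin0 : {A : Set a} → ¬ A → A ↔ Fin 0
empty↔Fin0 ¬a = mk↔ₛ′ (λ x → contradiction x ¬a) (λ ()) (λ ()) (λ x → contradiction x ¬a)

LocalPeakComp-0↔⊤ : ∀ m → LocalPeakComp m 0 ↔ ⊤
LocalPeakComp-0↔⊤ m = mk↔ₛ′ _ (λ _ → [] , tt , refl) (λ _ → refl) only-empty
  where
  only-empty : ∀ (α : LocalPeakComp m 0) → ([] , tt , refl) ≡ α
  only-empty ([] , tt , refl) = refl
  only-empty ((c , suc a) ∷ δ , lp , ())

¬LocalPeakComp⁺-0 : ∀ {m} → ¬ LocalPeakComp⁺ m 0
¬LocalPeakComp⁺-0 (_ , _ , _ , ())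

¬LocalPeakComp⁺-1 : ∀ {m} → ¬ LocalPeakComp⁺ m 1
¬LocalPeakComp⁺-1 ((_ , zero) ∷ _ , _ , () , _)
¬LocalPeakComp⁺-1 ((_ , suc _) ∷ _ , _ , _ , ())

LocalPeakComp⁺-2+↔ : ∀ m i → LocalPeakComp⁺ m (2 + i) ↔ LocalPeakComp m (1 + i)
LocalPeakComp⁺-2+↔ m i = restrict-↔ LocalPeak⁺-irrelevant LocalPeak-irrelevant id id
  (λ _ (_ , lp , s) → lp , suc-injective s) from (λ _ _ → refl) (λ _ _ → refl)
  where
  from : ∀ β → LocalPeak (1 + i) β → LocalPeak⁺ (2 + i) β
  from (_ ∷ _) (lp , s) = nonEmpty , lp , cong suc s

mutual
  peakCount : ℕ → ℕ → ℕ
  peakCount m zero = 1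
  peakCount m (suc k) = m * peakCount m k + peakCount⁺ m k

  peakCount⁺ : ℕ → ℕ → ℕ
  peakCount⁺ m 0 = 0
  peakCount⁺ m 1 = 0
  peakCount⁺ m (suc (suc i)) = peakCount m (suc i)

mutual
  LocalPeakComp↔Fin : ∀ m n → LocalPeakComp m n ↔ Fin (peakCount m n)
  LocalPeakComp↔Fin m zero = ↔-trans (LocalPeakComp-0↔⊤ m) (↔-sym 1↔⊤)
  LocalPeakComp↔Fin m (suc k) = begin
    LocalPeakComp m (suc k)
      ↔⟨ LocalPeakComp-suc↔ m k ⟩
    ((Fin m × LocalPeakComp m k) ⊎ LocalPeakComp⁺ m k)
      ↔⟨ (↔-refl ×-↔ LocalPeakComp↔Fin m k) ⊎-↔ LocalPeakComp⁺↔Fin m k ⟩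
    ((Fin m × Fin (peakCount m k)) ⊎ Fin (peakCount⁺ m k))
      ↔⟨ ↔-sym *↔× ⊎-↔ ↔-refl ⟩
    (Fin (m * peakCount m k) ⊎ Fin (peakCount⁺ m k))
      ↔⟨ ↔-sym +↔⊎ ⟩
    Fin (peakCount m (suc k)) ∎
    where open EquationalReasoning

  LocalPeakComp⁺↔Fin : ∀ m k → LocalPeakComp⁺ m k ↔ Fin (peakCount⁺ m k)
  LocalPeakComp⁺↔Fin m 0 = empty↔Fin0 ¬LocalPeakComp⁺-0
  LocalPeakComp⁺↔Fin m 1 = empty↔Fin0 ¬LocalPeakComp⁺-1
  LocalPeakComp⁺↔Fin m (suc (suc i)) = ↔-trans (LocalPeakComp⁺-2+↔ m i) (LocalPeakComp↔Fin m (suc i))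

mainTheorem12 : Σ (ℕ → ℕ → ℕ) λ f → ((∀ (m n : ℕ) → 1 ≤ m → 1 ≤ n → PeakComp m n ↔ Fin (f m n))
                  × (∀ (m : ℕ) → 1 ≤ m →
                      f m 1 ≡ m × f m 2 ≡ m ^ 2
                      × (∀ (n : ℕ) → 3 ≤ n → f m n ≡ m * f m (n ∸ 1) + f m (n ∸ 2))))
mainTheorem12 = peakCount , counts , λ m _ → peakCount-1 m , peakCount-2 m , recurrence m
  where
  counts : ∀ m n → 1 ≤ m → 1 ≤ n → PeakComp m n ↔ Fin (peakCount m n)
  counts m n _ _ = ↔-trans (PeakComp↔LocalPeakComp m n) (LocalPeakComp↔Fin m n)

  peakCount-1 : ∀ m → peakCount m 1 ≡ m
  peakCount-1 m = trans (+-identityʳ (m * 1)) (*-identityʳ m)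

  peakCount-2 : ∀ m → peakCount m 2 ≡ m ^ 2
  peakCount-2 m = trans (+-identityʳ _) (cong (m *_) (+-identityʳ (m * 1)))

  recurrence : ∀ m n → 3 ≤ n → peakCount m n ≡ m * peakCount m (n ∸ 1) + peakCount m (n ∸ 2)
  recurrence m (suc (suc (suc _))) _ = refl
  recurrence m 1 (s≤s ())
  recurrence m 2 (s≤s (s≤s ()))
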